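{- Let $(M,\mathrm{acc},\mathrm{rej})$ be a monitoring system and $P\subseteq\mathrm{Act}^\infty$. If some $m\in M$ is sound and complete for $P$, then $P=\mathrm{Act}^\infty$ or $P=\emptyset$.
   Context: $\mathrm{Act}$ is a finite set of actions; $\mathrm{Act}^\infty=\mathrm{Act}^*\cup\mathrm{Act}^\omega$ (finite and infinite traces). A monitoring system is a triple $(M,\mathrm{acc},\mathrm{rej})$ with $M$ nonempty and $\mathrm{acc},\mathrm{rej}\subseteq M\times\mathrm{Act}^\infty$ such that for every $m\in M$: (1) if $\mathrm{acc}(m,f)$ then $\mathrm{acc}(m,s)$ for some finite prefix $s$ of $f$, likewise for $\mathrm{rej}$; (2) if $\mathrm{acc}(m,s)$ for finite $s$ then $\mathrm{acc}(m,sf)$ for all $f\in\mathrm{Act}^\infty$, likewise for $\mathrm{rej}$. $m$ is sound for $P$ if $\mathrm{acc}(m,f)\Rightarrow f\in P$ and $\mathrm{rej}(m,f)\Rightarrow f\notin P$; complete for $P$ if $f\in P\Rightarrow\mathrm{acc}(m,f)$ and $f\notin P\Rightarrow\mathrm{rej}(m,f)$. -}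

module Defs where

open import Data.Nat using (ℕ; zero; suc)
open import Data.Fin using (Fin)
open import Data.List using (List; []; _∷_; _++_; length)
open import Data.Product using (Σ; ∃; _×_; _,_)
open import Data.Bool using (Bool; true; false)
open import Relation.Binary.PropositionalEquality using (_≡_)

-- Act^∞ = Act^* ∪ Act^ω : finite traces (lists) and infinite traces (streams ℕ → Act)
data Trace (A : Set) : Set where
  fin : List A → Trace A
  inf : (ℕ → A) → Trace A

takeω : {A : Set} → ℕ → (ℕ → A) → List A
takeω zero    σ = []
takeω (suc n) σ = σ zero ∷ takeω n (λ i → σ (suc i))

prependω : {A : Set} → List A → (ℕ → A) → (ℕ → A)
prependω []      σ i       = σ i
prependω (a ∷ s) σ zero    = a
prependω (a ∷ s) σ (suc i) = prependω s σ i

_·_ : {A : Set} → List A → Trace A → Trace A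
s · fin t = fin (s ++ t)
s · inf σ = inf (prependω s σ)

_≼_ : {A : Set} → List A → Trace A → Set
s ≼ fin t = ∃ λ u → t ≡ s ++ u
s ≼ inf σ = takeω (length s) σ ≡ s

record MonitoringSystem (A : Set) : Set₁ where
  field
    M        : Set
    nonempty : M
    acc      : M → Trace A → Set
    rej      : M → Trace A → Set
    acc-prefix : ∀ m f → acc m f → Σ (List A) λ s → (s ≼ f) × acc m (fin s)
    rej-prefix : ∀ m f → rej m f → Σ (List A) λ s → (s ≼ f) × rej m (fin s)
    acc-ext    : ∀ m s → acc m (fin s) → ∀ f → acc m (s · f)
    rej-ext    : ∀ m s → rej m (fin s) → ∀ f → rej m (s · f)

-- A property P ⊆ Act^∞, given by its (classical) characteristic function
Property : Set → Set
Property A = Trace A → Bool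

_∈P_ : {A : Set} → Trace A → Property A → Set
f ∈P P = P f ≡ true

_∉P_ : {A : Set} → Trace A → Property A → Set
f ∉P P = P f ≡ false

module _ {A : Set} (S : MonitoringSystem A) where
  open MonitoringSystem S

  Sound : M → Property A → Set
  Sound m P = (∀ f → acc m f → f ∈P P) × (∀ f → rej m f → f ∉P P)

  Complete : M → Property A → Set
  Complete m P = (∀ f → f ∈P P → acc m f) × (∀ f → f ∉P P → rej m f)

module Submission where

open import Defs
open import Data.Nat using (ℕ)
open import Data.Fin using (Fin)
open import Data.Product using (Σ; _×_; _,_)
open import Data.Sum using (_⊎_; inj₁; inj₂)
open import Data.Bool using (true; false)
open import Data.List using ([])
open import Relation.Binary.PropositionalEquality using (_≡_; refl; subst)

-- A verdict on the empty trace extends to every trace; by completeness the empty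
-- trace receives a verdict, and by soundness that verdict decides P everywhere.

[]·-identity : {A : Set} (f : Trace A) → [] · f ≡ f
[]·-identity (fin t) = refl
[]·-identity (inf σ) = refl

module _ {A : Set} (S : MonitoringSystem A) where
  open MonitoringSystem S

  acc-[]⇒acc-all : ∀ m → acc m (fin []) → ∀ f → acc m f
  acc-[]⇒acc-all m acc[] f = subst (acc m) ([]·-identity f) (acc-ext m [] acc[] f)

  rej-[]⇒rej-all : ∀ m → rej m (fin []) → ∀ f → rej m f
  rej-[]⇒rej-all m rej[] f = subst (rej m) ([]·-identity f) (rej-ext m [] rej[] f)

  sound-complete⇒trivial : ∀ m (P : Property A) → Sound S m P → Complete S m P →
    (∀ f → f ∈P P) ⊎ (∀ f → f ∉P P)
  sound-complete⇒trivial m P (accSound , rejSound) (accComplete , rejComplete)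
    with P (fin []) in []∈?P
  ... | true  = inj₁ λ f → accSound f (acc-[]⇒acc-all m (accComplete (fin []) []∈?P) f)
  ... | false = inj₂ λ f → rejSound f (rej-[]⇒rej-all m (rejComplete (fin []) []∈?P) f)

proposition1 : (k : ℕ) (S : MonitoringSystem (Fin k)) (P : Property (Fin k)) →
    Σ (MonitoringSystem.M S) (λ m → Sound S m P × Complete S m P) →
    (∀ f → f ∈P P) ⊎ (∀ f → f ∉P P)
proposition1 k S P (m , sound , complete) = sound-complete⇒trivial S m P sound complete
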